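{- Let $t\geq 1$ be an integer, let $P_t$ be the path with vertex set $[t+1]=\{1,\dots,t+1\}$ and edge set $\{\{i,i+1\}: i\in[t]\}$, and let $p\in\mathcal{P}(P_t)$. Then $$p(V(P_t))=\sum_{i=1}^{t}p(\{i,i+1\})-\sum_{i=2}^{t}p(\{i\}).$$
   Context: For a graph $F$, $\mathcal{P}(F)$ is the set of functions $p:2^{V(F)}\to\mathbb{R}$ such that: $p(\emptyset)=0$; $p(V(F))=1$; $p(A)\leq p(B)$ whenever $A\subseteq B\subseteq V(F)$; $p(A\cap B)+p(A\cup B)\leq p(A)+p(B)$ for all $A,B\subseteq V(F)$; and $p(A\cap B)+p(A\cup B)=p(A)+p(B)$ for all $A,B\subseteq V(F)$ such that $A\cap B$ separates $A\setminus B$ and $B\setminus A$, meaning there is no edge of $F$ between $A\setminus B$ and $B\setminus A$. -}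

module Defs where

open import Level using (Level; _⊔_)
open import Data.Nat as ℕ using (ℕ; zero; suc)
open import Data.Bool using (Bool; _∨_)
open import Data.Fin using (Fin; toℕ)
open import Data.Fin.Subset using (Subset; _∈_; _∉_; _⊆_; _∩_; _∪_; ⊤; ⊥)
open import Data.Vec using (tabulate)
open import Data.Sum using (_⊎_)
open import Data.Product using (_×_)
open import Relation.Nullary using (¬_; does)
open import Relation.Binary.Core using (Rel)
open import Relation.Binary.Structures using (IsTotalOrder)
open import Relation.Binary.PropositionalEquality using (_≡_)
open import Algebra.Bundles using (CommutativeRing)

record Graph (n : ℕ) : Set₁ where
  field
    Adj : Fin n → Fin n → Set

-- Ordered commutative rings (ℝ is an instance): a total order compatible
-- with addition and multiplication.
record IsOrderedCommRing {c ℓ ℓ₂} (R : CommutativeRing c ℓ)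
         (_≤_ : Rel (CommutativeRing.Carrier R) ℓ₂) : Set (c ⊔ ℓ ⊔ ℓ₂) where
  open CommutativeRing R
  field
    isTotalOrder : IsTotalOrder _≈_ _≤_
    +-mono       : ∀ {x y} z → x ≤ y → (x + z) ≤ (y + z)
    *-nonneg     : ∀ {x y} → 0# ≤ x → 0# ≤ y → 0# ≤ (x * y)

-- "A ∩ B separates A ∖ B and B ∖ A": no edge between A ∖ B and B ∖ A.
Separates : ∀ {n} → Graph n → Subset n → Subset n → Set
Separates F A B = ∀ u v → u ∈ A → u ∉ B → v ∈ B → v ∉ A → ¬ Graph.Adj F u v

record In𝒫 {c ℓ ℓ₂} (R : CommutativeRing c ℓ)
         (_≤_ : Rel (CommutativeRing.Carrier R) ℓ₂)
         {n : ℕ} (F : Graph n) (p : Subset n → CommutativeRing.Carrier R)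
         : Set (c ⊔ ℓ ⊔ ℓ₂) where
  open CommutativeRing R
  field
    empty      : p ⊥ ≈ 0#
    full       : p ⊤ ≈ 1#
    monotone   : ∀ A B → A ⊆ B → p A ≤ p B
    submodular : ∀ A B → (p (A ∩ B) + p (A ∪ B)) ≤ (p A + p B)
    modular    : ∀ A B → Separates F A B → (p (A ∩ B) + p (A ∪ B)) ≈ (p A + p B)

-- The path P_t. Vertex v : Fin (t+1) stands for the vertex labelled
-- suc (toℕ v) ∈ [t+1] = {1,…,t+1}; edges are {i, i+1}.
label : ∀ {n} → Fin n → ℕ
label v = suc (toℕ v)

Path : (t : ℕ) → Graph (suc t)
Path t = record { Adj = λ u v → (suc (label u) ≡ label v) ⊎ (suc (label v) ≡ label u) }

single : (t : ℕ) → ℕ → Subset (suc t)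
single t i = tabulate (λ v → does (label v ℕ.≟ i))

pair : (t : ℕ) → ℕ → Subset (suc t)
pair t i = tabulate (λ v → does (label v ℕ.≟ i) ∨ does (label v ℕ.≟ suc i))

-- ∑_{i=a}^{b} f i in a commutative ring (empty sum = 0 when b < a).
module _ {c ℓ} (R : CommutativeRing c ℓ) where
  open CommutativeRing R
  sumFrom : ℕ → ℕ → (ℕ → Carrier) → Carrier
  sumFrom a zero    f = 0#
  sumFrom a (suc k) f = f a + sumFrom (suc a) k f

  ∑[_⋯_] : ℕ → ℕ → (ℕ → Carrier) → Carrier
  ∑[ a ⋯ b ] f = sumFrom a (suc b ℕ.∸ a) f

-- Write Q k = {1, …, k} for the initial segments of the path. The set
-- Q k ∩ {k, k+1} = {k} separates Q k ∖ {k, k+1} = {1, …, k−1} from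
-- {k, k+1} ∖ Q k = {k+1}, so modularity gives
--   p {k} + p (Q (k+1)) = p (Q k) + p {k, k+1}.
-- Summing over k = 2, …, t telescopes from Q 2 = {1, 2} to Q (t+1) = V(P_t).
module Submission where

open import Defs
import Data.Nat as ℕ
open import Data.Nat using (ℕ; zero; suc; _≤_; _<_; _≤?_; _≟_; z≤n; s≤s; s≤s⁻¹)
open import Data.Nat.Properties
  using (≤-refl; m≤n⇒m≤1+n; n≤1+n; m≤n⇒m<n∨m≡n; ≤∧≢⇒<; ≰⇒>; <⇒≱; <-irrefl; <-trans; n<1+n)
import Data.Nat.Properties as ℕₚ
open import Data.Bool using (Bool; _∧_; _∨_)
open import Data.Fin using (Fin; toℕ)
open import Data.Fin.Properties using (toℕ<n)
open import Data.Fin.Subset using (Subset; _∈_; _∩_; _∪_; ⊤)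
open import Data.Fin.Subset.Properties using (⊆-antisym; ∈⊤)
open import Data.Vec using (tabulate; zipWith; _∷_)
open import Data.Vec.Properties using (lookup∘tabulate; []=⇒lookup; lookup⇒[]=; tabulate-cong)
open import Data.Sum using (_⊎_; inj₁; inj₂)
open import Data.Product using (_×_; _,_)
open import Function using (_⇔_; mk⇔; Equivalence)
open import Relation.Nullary using (¬_; does; proof; contradiction)
open import Relation.Nullary.Reflects using (Reflects; invert)
open import Relation.Nullary.Decidable using (does-⇔; dec-true; _×-dec_; _⊎-dec_)
open import Relation.Binary.Core using (Rel)
open import Relation.Unary using (Pred; Decidable)
open import Relation.Binary.PropositionalEquality using (_≡_; refl; sym; trans; cong; cong₂; subst)
open import Algebra.Bundles using (CommutativeRing)
import Algebra.Properties.Group as GroupProperties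
import Algebra.Properties.Quasigroup as QuasigroupProperties
import Relation.Binary.Reasoning.Setoid as SetoidReasoning

zipWith-tabulate : ∀ {a b c} {A : Set a} {B : Set b} {C : Set c} {n}
                   (_⊕_ : A → B → C) (f : Fin n → A) (g : Fin n → B) →
                   zipWith _⊕_ (tabulate f) (tabulate g) ≡ tabulate (λ i → f i ⊕ g i)
zipWith-tabulate {n = zero}  _⊕_ f g = refl
zipWith-tabulate {n = suc n} _⊕_ f g =
  cong (f Fin.zero ⊕ g Fin.zero ∷_) (zipWith-tabulate _⊕_ (λ i → f (Fin.suc i)) (λ i → g (Fin.suc i)))

∈-tabulate-does : ∀ {n p} {P : Pred (Fin n) p} (P? : Decidable P) {x : Fin n} →
                  x ∈ tabulate (λ y → does (P? y)) ⇔ P x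
∈-tabulate-does {n} {P = P} P? {x} = mk⇔
  (λ x∈P → invert (subst (Reflects (P x)) (trans (sym (lookup∘tabulate f x)) ([]=⇒lookup x∈P)) (proof (P? x))))
  (λ Px → lookup⇒[]= x _ (trans (lookup∘tabulate f x) (dec-true (P? x) Px)))
  where
  f : Fin n → Bool
  f y = does (P? y)

module _ {n p q r} {P : Pred (Fin n) p} {Q : Pred (Fin n) q} {S : Pred (Fin n) r}
         (P? : Decidable P) (Q? : Decidable Q) (S? : Decidable S) where

  ∩-tabulate-does : (∀ {x} → (P x × Q x) ⇔ S x) →
                    tabulate (λ x → does (P? x)) ∩ tabulate (λ x → does (Q? x)) ≡ tabulate (λ x → does (S? x))
  ∩-tabulate-does P×Q⇔S = trans (zipWith-tabulate _∧_ (λ x → does (P? x)) (λ x → does (Q? x)))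
                                (tabulate-cong λ x → does-⇔ P×Q⇔S (P? x ×-dec Q? x) (S? x))

  ∪-tabulate-does : (∀ {x} → (P x ⊎ Q x) ⇔ S x) →
                    tabulate (λ x → does (P? x)) ∪ tabulate (λ x → does (Q? x)) ≡ tabulate (λ x → does (S? x))
  ∪-tabulate-does P⊎Q⇔S = trans (zipWith-tabulate _∨_ (λ x → does (P? x)) (λ x → does (Q? x)))
                                (tabulate-cong λ x → does-⇔ P⊎Q⇔S (P? x ⊎-dec Q? x) (S? x))

prefix : (t k : ℕ) → Subset (suc t)
prefix t k = tabulate (λ v → does (label v ≤? k))

prefix∩pair≡single : ∀ t k → prefix t k ∩ pair t k ≡ single t k
prefix∩pair≡single t k =
  ∩-tabulate-does (λ v → label v ≤? k) (λ v → label v ≟ k ⊎-dec label v ≟ suc k) (λ v → label v ≟ k)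
                  (mk⇔ to from)
  where
  to : ∀ {l} → l ≤ k × (l ≡ k ⊎ l ≡ suc k) → l ≡ k
  to (_   , inj₁ l≡k) = l≡k
  to (l≤k , inj₂ refl) = contradiction l≤k (<-irrefl refl)
  from : ∀ {l} → l ≡ k → l ≤ k × (l ≡ k ⊎ l ≡ suc k)
  from refl = ≤-refl , inj₁ refl

prefix∪pair≡prefix : ∀ t k → prefix t k ∪ pair t k ≡ prefix t (suc k)
prefix∪pair≡prefix t k =
  ∪-tabulate-does (λ v → label v ≤? k) (λ v → label v ≟ k ⊎-dec label v ≟ suc k) (λ v → label v ≤? suc k)
                  (mk⇔ to from)
  where
  to : ∀ {l} → l ≤ k ⊎ (l ≡ k ⊎ l ≡ suc k) → l ≤ suc k
  to (inj₁ l≤k)         = m≤n⇒m≤1+n l≤k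
  to (inj₂ (inj₁ refl)) = n≤1+n k
  to (inj₂ (inj₂ refl)) = ≤-refl
  from : ∀ {l} → l ≤ suc k → l ≤ k ⊎ (l ≡ k ⊎ l ≡ suc k)
  from l≤1+k with m≤n⇒m<n∨m≡n l≤1+k
  ... | inj₁ l<1+k = inj₁ (s≤s⁻¹ l<1+k)
  ... | inj₂ l≡1+k = inj₂ (inj₂ l≡1+k)

prefix2≡pair1 : ∀ t → prefix t 2 ≡ pair t 1
prefix2≡pair1 t =
  tabulate-cong λ v → does-⇔ (mk⇔ to from) (label v ≤? 2) (label v ≟ 1 ⊎-dec label v ≟ 2)
  where
  to : ∀ {m} → suc m ≤ 2 → suc m ≡ 1 ⊎ suc m ≡ 2
  to {zero}        _ = inj₁ refl
  to {suc zero}    _ = inj₂ refl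
  to {suc (suc m)} (s≤s (s≤s ()))
  from : ∀ {m} → suc m ≡ 1 ⊎ suc m ≡ 2 → suc m ≤ 2
  from (inj₁ refl) = s≤s z≤n
  from (inj₂ refl) = ≤-refl

prefix-last≡⊤ : ∀ t → prefix t (suc t) ≡ ⊤
prefix-last≡⊤ t =
  ⊆-antisym (λ _ → ∈⊤) (λ {v} _ → Equivalence.from (∈-tabulate-does (λ w → label w ≤? suc t)) (toℕ<n v))

-- Vertices of Q k outside {k, k+1} have label < k and those outside Q k have label > k,
-- so the two sides are at distance at least 2 along the path.
prefix-separates-pair : ∀ t k → Separates (Path t) (prefix t k) (pair t k)
prefix-separates-pair t k u v u∈prefix u∉pair _ v∉prefix = not-adjacent u<k k<v
  where
  u≤k : label u ≤ k
  u≤k = Equivalence.to (∈-tabulate-does (λ w → label w ≤? k)) u∈prefix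
  u<k : label u < k
  u<k = ≤∧≢⇒< u≤k λ u≡k →
    u∉pair (Equivalence.from (∈-tabulate-does (λ w → label w ≟ k ⊎-dec label w ≟ suc k)) (inj₁ u≡k))
  k<v : k < label v
  k<v = ≰⇒> λ v≤k → v∉prefix (Equivalence.from (∈-tabulate-does (λ w → label w ≤? k)) v≤k)
  not-adjacent : ∀ {l m} → l < k → k < m → ¬ (suc l ≡ m ⊎ suc m ≡ l)
  not-adjacent l<k k<m (inj₁ refl) = <⇒≱ k<m l<k
  not-adjacent {l} {m} l<k k<m (inj₂ refl) = <-irrefl refl (<-trans (<-trans l<k k<m) (n<1+n m))

module _ {c ℓ} (R : CommutativeRing c ℓ) where
  open CommutativeRing R
  open SetoidReasoning setoid

  sumFrom-telescope : (q s d : ℕ → Carrier) → (∀ k → s k + q (suc k) ≈ q k + d k) →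
                      ∀ a n → sumFrom R a n s + q (a ℕ.+ n) ≈ q a + sumFrom R a n d
  sumFrom-telescope q s d step a zero = begin
    0# + q (a ℕ.+ 0) ≈⟨ +-comm 0# _ ⟩
    q (a ℕ.+ 0) + 0# ≡⟨ cong (λ b → q b + 0#) (ℕₚ.+-identityʳ a) ⟩
    q a + 0#         ∎
  sumFrom-telescope q s d step a (suc n) = begin
    (s a + sumFrom R (suc a) n s) + q (a ℕ.+ suc n) ≡⟨ cong (λ b → s a + sumFrom R (suc a) n s + q b) (ℕₚ.+-suc a n) ⟩
    (s a + sumFrom R (suc a) n s) + q (suc a ℕ.+ n) ≈⟨ +-assoc _ _ _ ⟩
    s a + (sumFrom R (suc a) n s + q (suc a ℕ.+ n)) ≈⟨ +-congˡ (sumFrom-telescope q s d step (suc a) n) ⟩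
    s a + (q (suc a) + sumFrom R (suc a) n d)     ≈⟨ +-assoc _ _ _ ⟨
    (s a + q (suc a)) + sumFrom R (suc a) n d     ≈⟨ +-congʳ (step a) ⟩
    (q a + d a) + sumFrom R (suc a) n d           ≈⟨ +-assoc _ _ _ ⟩
    q a + (d a + sumFrom R (suc a) n d)           ∎

  module _ {ℓ₂} {_≤ᴿ_ : Rel Carrier ℓ₂} {t} {p : Subset (suc t) → Carrier}
           (p∈𝒫 : In𝒫 R _≤ᴿ_ (Path t) p) where
    open In𝒫 p∈𝒫

    single+prefix≈prefix+pair : ∀ k → p (single t k) + p (prefix t (suc k)) ≈ p (prefix t k) + p (pair t k)
    single+prefix≈prefix+pair k = begin
      p (single t k) + p (prefix t (suc k))
        ≡⟨ cong₂ (λ A B → p A + p B) (prefix∩pair≡single t k) (prefix∪pair≡prefix t k) ⟨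
      p (prefix t k ∩ pair t k) + p (prefix t k ∪ pair t k)
        ≈⟨ modular (prefix t k) (pair t k) (prefix-separates-pair t k) ⟩
      p (prefix t k) + p (pair t k) ∎

lemma3p1 : ∀ {c ℓ ℓ₂} (R : CommutativeRing c ℓ) (_≤ᴿ_ : Rel (CommutativeRing.Carrier R) ℓ₂)
             → IsOrderedCommRing R _≤ᴿ_
             → (t : ℕ) → 1 ≤ t
             → (p : Subset (suc t) → CommutativeRing.Carrier R)
             → In𝒫 R _≤ᴿ_ (Path t) p
             → CommutativeRing._≈_ R (p ⊤)
                 (CommutativeRing._-_ R (∑[_⋯_] R 1 t (λ i → p (pair t i)))
                                        (∑[_⋯_] R 2 t (λ i → p (single t i))))
lemma3p1 R _ _ t@(suc j) _ p p∈𝒫 = x≈z//y (p ⊤) (sumFrom R 2 j singles) (sumFrom R 1 t pairs) telescoped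
  where
  open CommutativeRing R
  open QuasigroupProperties (GroupProperties.quasigroup +-group) using (x≈z//y)
  open SetoidReasoning setoid

  singles pairs : ℕ → Carrier
  singles i = p (single t i)
  pairs   i = p (pair t i)

  telescoped : p ⊤ + sumFrom R 2 j singles ≈ sumFrom R 1 t pairs
  telescoped = begin
    p ⊤ + sumFrom R 2 j singles                ≈⟨ +-comm _ _ ⟩
    sumFrom R 2 j singles + p ⊤                ≡⟨ cong (λ A → sumFrom R 2 j singles + p A) (prefix-last≡⊤ t) ⟨
    sumFrom R 2 j singles + p (prefix t (suc t))
      ≈⟨ sumFrom-telescope R (λ k → p (prefix t k)) singles pairs (single+prefix≈prefix+pair R p∈𝒫) 2 j ⟩
    p (prefix t 2) + sumFrom R 2 j pairs       ≡⟨ cong (λ A → p A + sumFrom R 2 j pairs) (prefix2≡pair1 t) ⟩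
    sumFrom R 1 t pairs                        ∎
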